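{- Let $n\geq 3$ be an integer and let $(x_1,\ldots,x_n)$ be positive integers with $x_1\leq\cdots\leq x_n$ satisfying $\sigma_2(x_1,\ldots,x_n)=\sigma_n(x_1,\ldots,x_n)$. Write $\overline{X}_{n-2}=(x_1,\ldots,x_{n-2})$. Then $$x_{n-1}=\frac{\sigma_1(\overline{X}_{n-2})+d_1}{\sigma_{n-2}(\overline{X}_{n-2})-1},\qquad x_n=\frac{\sigma_1(\overline{X}_{n-2})+d_2}{\sigma_{n-2}(\overline{X}_{n-2})-1},$$ where $d_1,d_2$ are non-negative integers such that $$d_1d_2=\sigma_1(\overline{X}_{n-2})^2+\sigma_2(\overline{X}_{n-2})\bigl(\sigma_{n-2}(\overline{X}_{n-2})-1\bigr).$$
   Context: $\sigma_k(y_1,\ldots,y_m)=\sum_{i_1<\cdots<i_k}y_{i_1}\cdots y_{i_k}$ denotes the $k$-th elementary symmetric polynomial (with $\sigma_k=0$ if $k>m$); $\sigma_{n-2}(\overline{X}_{n-2})=x_1\cdots x_{n-2}$. -}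

module Defs where

open import Data.Nat using (ℕ; zero; suc; _+_; _*_)
open import Data.Fin using (Fin; zero; suc)

σ : ℕ → {m : ℕ} → (Fin m → ℕ) → ℕ
σ zero    _ = 1
σ (suc k) {zero}  y = 0
σ (suc k) {suc m} y = y zero * σ k (λ i → y (suc i)) + σ (suc k) (λ i → y (suc i))

{-# OPTIONS --safe #-}
module Submission where

open import Defs
open import Data.Nat using (ℕ; zero; suc; _+_; _*_; _∸_; _^_; _≤_; _<_; s≤s; >-nonZero)
open import Data.Nat.Properties
open import Data.Nat.Tactic.RingSolver using (solve-∀)
open import Data.Fin using (Fin; zero; suc; inject₁; fromℕ) renaming (_≤_ to _≤ᶠ_)
open import Data.Product using (Σ; _×_; _,_)
open import Data.Empty using (⊥-elim)
open import Relation.Binary.PropositionalEquality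
  using (_≡_; refl; sym; trans; cong; cong₂; module ≡-Reasoning)

-- Write X̄ = (x₁, …, x_{n-2}), a = x_{n-1}, b = x_n and sᵢ = σᵢ(X̄). Peeling a and b off gives
--   σ₂(x) = s₂ + (a + b) s₁ + ab   and   σₙ(x) = ab σ_{n-2}(X̄),
-- so the hypothesis reads s₂ + (a + b) s₁ = ab q with q = σ_{n-2}(X̄) - 1. Hence b s₁ ≤ ab q,
-- so d₁ = a q - s₁ ≥ 0 (and likewise d₂ = b q - s₁ ≥ 0), and
--   d₁ d₂ = q (ab q - (a + b) s₁) + s₁² = q s₂ + s₁².

init : ∀ {m} → (Fin (suc m) → ℕ) → Fin m → ℕ
init y i = y (inject₁ i)

σ-snoc : ∀ {m} k (y : Fin (suc m) → ℕ) → σ (suc k) y ≡ σ (suc k) (init y) + y (fromℕ m) * σ k (init y)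
σ-snoc {zero}  zero    y = +-comm (y zero * 1) 0
σ-snoc {zero}  (suc k) y = +-comm (y zero * 0) 0
σ-snoc {suc m} zero    y
  rewrite σ-snoc {m} zero (λ i → y (suc i)) =
  regroup (y zero) (σ 1 (λ i → y (suc (inject₁ i)))) (y (suc (fromℕ m)))
  where
  regroup : ∀ a s l → a * 1 + (s + l * 1) ≡ (a * 1 + s) + l * 1
  regroup = solve-∀
σ-snoc {suc m} (suc k) y
  rewrite σ-snoc {m} (suc k) (λ i → y (suc i)) | σ-snoc {m} k (λ i → y (suc i)) =
  regroup (y zero) (σ k (λ i → y (suc (inject₁ i)))) (σ (suc k) (λ i → y (suc (inject₁ i))))
          (σ (suc (suc k)) (λ i → y (suc (inject₁ i)))) (y (suc (fromℕ m)))
  where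
  regroup : ∀ a p q r l → a * (q + l * p) + (r + l * q) ≡ (a * q + r) + l * (a * p + q)
  regroup = solve-∀

σ-beyond-length : ∀ {m} k (y : Fin m → ℕ) → m < k → σ k y ≡ 0
σ-beyond-length {zero}  (suc k) y _ = refl
σ-beyond-length {suc m} (suc k) y (s≤s m<k)
  rewrite σ-beyond-length k (λ i → y (suc i)) m<k
        | σ-beyond-length (suc k) (λ i → y (suc i)) (m<n⇒m<1+n m<k)
        | *-zeroʳ (y zero) = refl

σ-top-snoc : ∀ {m} (y : Fin (suc m) → ℕ) → σ (suc m) y ≡ y (fromℕ m) * σ m (init y)
σ-top-snoc {m} y rewrite σ-snoc m y | σ-beyond-length (suc m) (init y) (n<1+n m) = refl

module _ {m : ℕ} (x : Fin (suc (suc m)) → ℕ) where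

  private
    a b : ℕ
    a = x (inject₁ (fromℕ m))
    b = x (fromℕ (suc m))

  σ₂-snoc² : σ 2 x ≡ σ 2 (init (init x)) + a * σ 1 (init (init x)) + b * σ 1 (init (init x)) + a * b
  σ₂-snoc² rewrite σ-snoc 1 x | σ-snoc 1 (init x) | σ-snoc 0 (init x) =
    regroup (σ 2 (init (init x))) (σ 1 (init (init x))) a b
    where
    regroup : ∀ s₂ s₁ a b → s₂ + a * s₁ + b * (s₁ + a * 1) ≡ s₂ + a * s₁ + b * s₁ + a * b
    regroup = solve-∀

  σ-top-snoc² : σ (suc (suc m)) x ≡ a * b * σ m (init (init x))
  σ-top-snoc² rewrite σ-top-snoc x | σ-top-snoc (init x) =
    regroup a b (σ m (init (init x)))
    where
    regroup : ∀ a b p → b * (a * p) ≡ a * b * p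
    regroup = solve-∀

+≡*⇒≡*∸1 : ∀ {s c p} → 0 < c → s + c ≡ c * p → s ≡ c * (p ∸ 1)
+≡*⇒≡*∸1 {s} {c} {zero}  0<c eq = ⊥-elim (<⇒≢ 0<c (sym (m+n≡0⇒n≡0 s (trans eq (*-zeroʳ c)))))
+≡*⇒≡*∸1 {s} {c} {suc q} _   eq = +-cancelʳ-≡ c s (c * q) (trans eq (trans (*-suc c q) (+-comm c (c * q))))

≤*-of-balance : ∀ {s₁ s₂ q a b} → s₂ + a * s₁ + b * s₁ ≡ a * b * q → 0 < b → s₁ ≤ a * q
≤*-of-balance {s₁} {s₂} {q} {a} {b} balance 0<b = *-cancelˡ-≤ b {{>-nonZero 0<b}} (begin
  b * s₁                ≤⟨ m≤n+m (b * s₁) (s₂ + a * s₁) ⟩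
  s₂ + a * s₁ + b * s₁  ≡⟨ balance ⟩
  a * b * q             ≡⟨ reorder a b q ⟩
  b * (a * q)           ∎)
  where
  open ≤-Reasoning
  reorder : ∀ a b q → a * b * q ≡ b * (a * q)
  reorder = solve-∀

module _ {s₁ s₂ q a b : ℕ} (balance : s₂ + a * s₁ + b * s₁ ≡ a * b * q) where

  shifted-product : ∀ {d₁ d₂} → s₁ + d₁ ≡ a * q → s₁ + d₂ ≡ b * q → d₁ * d₂ ≡ s₁ ^ 2 + s₂ * q
  shifted-product {d₁} {d₂} e₁ e₂ = +-cancelˡ-≡ (s₁ * s₁ + s₁ * d₁ + s₁ * d₂) _ _ (begin
    s₁ * s₁ + s₁ * d₁ + s₁ * d₂ + d₁ * d₂          ≡⟨ expand s₁ d₁ d₂ ⟩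
    (s₁ + d₁) * (s₁ + d₂)                          ≡⟨ cong₂ _*_ e₁ e₂ ⟩
    (a * q) * (b * q)                              ≡⟨ reorder a b q ⟩
    q * (a * b * q)                                ≡⟨ cong (q *_) balance ⟨
    q * (s₂ + a * s₁ + b * s₁)                     ≡⟨ distribute s₁ s₂ a b q ⟩
    q * s₂ + s₁ * (a * q) + s₁ * (b * q)           ≡⟨ cong₂ (λ u v → q * s₂ + s₁ * u + s₁ * v) e₁ e₂ ⟨
    q * s₂ + s₁ * (s₁ + d₁) + s₁ * (s₁ + d₂)       ≡⟨ collect s₁ s₂ q d₁ d₂ ⟩
    s₁ * s₁ + s₁ * d₁ + s₁ * d₂ + (s₁ ^ 2 + s₂ * q) ∎)
    where
    open ≡-Reasoning
    expand : ∀ s d₁ d₂ → s * s + s * d₁ + s * d₂ + d₁ * d₂ ≡ (s + d₁) * (s + d₂)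
    expand = solve-∀
    reorder : ∀ a b q → (a * q) * (b * q) ≡ q * (a * b * q)
    reorder = solve-∀
    distribute : ∀ s₁ s₂ a b q → q * (s₂ + a * s₁ + b * s₁) ≡ q * s₂ + s₁ * (a * q) + s₁ * (b * q)
    distribute = solve-∀
    collect : ∀ s₁ s₂ q d₁ d₂ →
              q * s₂ + s₁ * (s₁ + d₁) + s₁ * (s₁ + d₂) ≡ s₁ * s₁ + s₁ * d₁ + s₁ * d₂ + (s₁ * (s₁ * 1) + s₂ * q)
    collect = solve-∀

  balanced-factorisation : 0 < a → 0 < b →
    Σ ℕ λ d₁ → Σ ℕ λ d₂ → (a * q ≡ s₁ + d₁) × (b * q ≡ s₁ + d₂) × (d₁ * d₂ ≡ s₁ ^ 2 + s₂ * q)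
  balanced-factorisation 0<a 0<b = a * q ∸ s₁ , b * q ∸ s₁ , sym e₁ , sym e₂ , shifted-product e₁ e₂
    where
    swap-summands : ∀ u v w → u + v + w ≡ u + w + v
    swap-summands = solve-∀
    swapped : s₂ + b * s₁ + a * s₁ ≡ b * a * q
    swapped = trans (swap-summands s₂ (b * s₁) (a * s₁)) (trans balance (cong (_* q) (*-comm a b)))
    e₁ : s₁ + (a * q ∸ s₁) ≡ a * q
    e₁ = m+[n∸m]≡n (≤*-of-balance {a = a} balance 0<b)
    e₂ : s₁ + (b * q ∸ s₁) ≡ b * q
    e₂ = m+[n∸m]≡n (≤*-of-balance {a = b} swapped 0<a)

theorem2p5 : (m : ℕ) → 1 ≤ m → (x : Fin (suc (suc m)) → ℕ)
    → (∀ i → 0 < x i)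
    → (∀ i j → i ≤ᶠ j → x i ≤ x j)
    → σ 2 x ≡ σ (suc (suc m)) x
    → Σ ℕ λ d₁ → Σ ℕ λ d₂ →
        (x (inject₁ (fromℕ m)) * (σ m (λ i → x (inject₁ (inject₁ i))) ∸ 1)
           ≡ σ 1 (λ i → x (inject₁ (inject₁ i))) + d₁)
      × (x (fromℕ (suc m)) * (σ m (λ i → x (inject₁ (inject₁ i))) ∸ 1)
           ≡ σ 1 (λ i → x (inject₁ (inject₁ i))) + d₂)
      × (d₁ * d₂ ≡ σ 1 (λ i → x (inject₁ (inject₁ i))) ^ 2
           + σ 2 (λ i → x (inject₁ (inject₁ i))) * (σ m (λ i → x (inject₁ (inject₁ i))) ∸ 1))
theorem2p5 m _ x positive _ σ₂≡σₙ =
  balanced-factorisation (+≡*⇒≡*∸1 (*-mono-< (positive _) (positive _)) balance) (positive _) (positive _)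
  where
  X : Fin m → ℕ
  X = init (init x)
  a b : ℕ
  a = x (inject₁ (fromℕ m))
  b = x (fromℕ (suc m))
  balance : σ 2 X + a * σ 1 X + b * σ 1 X + a * b ≡ a * b * σ m X
  balance = trans (sym (σ₂-snoc² x)) (trans σ₂≡σₙ (σ-top-snoc² x))
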